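{- Let $\Pi_q$ be a projective plane of order $q$, where $q$ is a prime power, and let $\mathcal S$ be a generalized KM-arc of type $(0,m,t)$ in $\Pi_q$ having no $0$-secants. Then $\mathcal S$ is one of the following: a set of $q+1$ collinear points ($m=1$); a unital ($t=1$, $m=\sqrt q+1$); the complement of a Baer subplane ($t=q-\sqrt q$, $m=q$); the complement of a point ($t=q$, $m=q+1$).
   Context: A generalized KM-arc of type $(0,m,t)$ in a projective plane of order $q$ is a proper non-empty subset $\mathcal S$ of the points with $|\mathcal S|=q(m-1)+t$ such that every line meets $\mathcal S$ in $0$, $m$ or $t$ points. A $0$-secant is a line disjoint from $\mathcal S$. A unital is a set of $q\sqrt q+1$ points meeting every line in $1$ or $\sqrt q+1$ points; a Baer subplane is a subplane of order $\sqrt q$. -}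

module Defs where

open import Data.Nat using (ℕ; _+_; _*_; _∸_; _^_; _≤_; suc)
open import Data.Nat.Primality using (Prime)
open import Data.Fin using (Fin)
open import Data.Fin.Subset using (Subset; _∈_; _∉_; _⊆_; _∩_; ∣_∣; ∁; Nonempty)
open import Data.Product using (Σ; ∃; _×_)
open import Data.Sum using (_⊎_)
open import Relation.Binary.PropositionalEquality using (_≡_; _≢_)
open import Relation.Nullary using (¬_)

IsPrimePower : ℕ → Set
IsPrimePower q = Σ ℕ λ p → Σ ℕ λ k → Prime p × q ≡ p ^ suc k

GeneralPosition : {np nl : ℕ} → (Fin nl → Subset np) → (Fin 4 → Fin np) → Set
GeneralPosition {np} {nl} L f =
  ((i j : Fin 4) → i ≢ j → f i ≢ f j) ×
  ((l : Fin nl) (i j k : Fin 4) → i ≢ j → j ≢ k → i ≢ k →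
     ¬ (f i ∈ L l × f j ∈ L l × f k ∈ L l))

record ProjectivePlane (q : ℕ) : Set where
  field
    np nl : ℕ
    L     : Fin nl → Subset np
    joinP : (p r : Fin np) → p ≢ r →
            Σ (Fin nl) λ l → (p ∈ L l × r ∈ L l) ×
              ((l' : Fin nl) → p ∈ L l' → r ∈ L l' → l' ≡ l)
    meetL : (l l' : Fin nl) → l ≢ l' → ∣ L l ∩ L l' ∣ ≡ 1
    quad  : Σ (Fin 4 → Fin np) λ f → GeneralPosition L f
    order : (l : Fin nl) → ∣ L l ∣ ≡ suc q

module _ {q : ℕ} (Π : ProjectivePlane q) where
  open ProjectivePlane Π

  -- generalized KM-arc of type (0,m,t): proper non-empty subset S with
  -- |S| = q(m-1)+t (written |S| + q = q m + t) such that every line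
  -- meets S in 0, m or t points
  IsGenKMArc : Subset np → ℕ → ℕ → Set
  IsGenKMArc S m t =
    Nonempty S × Nonempty (∁ S) ×
    (∣ S ∣ + q ≡ q * m + t) ×
    ((l : Fin nl) → ∣ L l ∩ S ∣ ≡ 0 ⊎ ∣ L l ∩ S ∣ ≡ m ⊎ ∣ L l ∩ S ∣ ≡ t)

  NoZeroSecant : Subset np → Set
  NoZeroSecant S = (l : Fin nl) → ¬ (∣ L l ∩ S ∣ ≡ 0)

  -- unital (here √q = r): q√q+1 points, every line meets it in 1 or √q+1 points
  IsUnital : ℕ → Subset np → Set
  IsUnital r U = (∣ U ∣ ≡ q * r + 1) ×
    ((l : Fin nl) → ∣ L l ∩ U ∣ ≡ 1 ⊎ ∣ L l ∩ U ∣ ≡ r + 1)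

  -- B is (the point set of) a subplane of order r: the lines of Π meeting B
  -- in at least two points, restricted to B, form a projective plane of
  -- order r (two points of B are automatically joined by such a line).
  IsSubplane : ℕ → Subset np → Set
  IsSubplane r B =
    ((l : Fin nl) → 2 ≤ ∣ L l ∩ B ∣ → ∣ L l ∩ B ∣ ≡ suc r) ×
    ((l l' : Fin nl) → 2 ≤ ∣ L l ∩ B ∣ → 2 ≤ ∣ L l' ∩ B ∣ →
       ∃ λ p → p ∈ B × p ∈ L l × p ∈ L l') ×
    (Σ (Fin 4 → Fin np) λ f → ((i : Fin 4) → f i ∈ B) × GeneralPosition L f)

  IsBaerSubplane : Subset np → Set
  IsBaerSubplane B = Σ ℕ λ r → r * r ≡ q × IsSubplane r B

  IsCollinearQ+1 : Subset np → Set
  IsCollinearQ+1 S = ∣ S ∣ ≡ suc q × ∃ λ l → S ⊆ L l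

-- Let b be the number of t-lines through a point P; the other q + 1 − b lines through P are
-- m-lines.  Counting the points of S on the lines through P gives m (q + 1 − b) + t b =
-- |S| + q [P ∈ S], and with |S| = q (m − 1) + t this reads (m − t)(b − 1) = q [P ∉ S].  Hence
-- m ≠ t, every point of S lies on exactly one t-line, and every point outside S on b lines with
-- (m − t)(b − 1) = q.
--
-- If m < t, a point outside S lies on no t-line and t = m + q ≤ q + 1, so m = 1 and S is the
-- t-line through any of its points.
--
-- If m = t + d with d ≥ 1, then d ∣ q.  Counting the flags on t-lines once from S and once from
-- its complement gives t t′ = d (d − 1), where t′ = q + 1 − m, so that t + t′ + d = q + 1.  Since
-- q and d are powers of the same prime p and p ∤ q + 1, p does not divide both t and t′; if
-- p ∤ t′ then d ∣ t, and reducing t + t′ + d = q + 1 modulo d gives t′ = 1 and d² = q (and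
-- symmetrically for t).  So either d = 1, t′ = 0 and S is the complement of a point, or d² = q and
-- S is a unital (t = 1), or t′ = 1: then ∁S meets every line in 1 or d + 1 points, two t-lines
-- meet outside S, and two further points of ∁S on each of two t-lines through a point of ∁S form
-- a quadrangle, so ∁S is a Baer subplane.

module Submission where

open import Defs
open import Data.Nat using (ℕ; zero; suc; _+_; _*_; _∸_; _^_; _≤_; _<_; z≤n; s≤s; _≡ᵇ_;
  >-nonZero; ≢-nonZero; nonTrivial⇒n>1)
open import Data.Nat.Properties
open import Data.Nat.Divisibility
open import Data.Nat.DivMod using (_%_; [m+kn]%n≡m%n; m<n⇒m%n≡m)
open import Data.Nat.Primality using (Prime; euclidsLemma; prime⇒nonZero; prime⇒nonTrivial; ¬prime[1])
open import Data.Nat.Coprimality using (Coprime; coprime-divisor)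
open import Data.Nat.Tactic.RingSolver using (solve-∀)
open import Data.Bool using (Bool; true; false; _∧_; not; T)
open import Data.Bool.Properties using (not-injective; not-involutive)
open import Data.Unit using (tt)
open import Data.Fin using (Fin; zero; suc; punchIn; punchOut) renaming (_≟_ to _≟F_)
open import Data.Fin.Patterns using (0F; 1F; 2F; 3F)
open import Data.Fin.Properties using (punchInᵢ≢i; punchIn-injective; punchOut-injective)
open import Data.Fin.Subset using (Subset; _∈_; _∩_; ∁; ∣_∣; _⊆_; Nonempty)
open import Data.Fin.Subset.Properties using (∣∁p∣≡n∸∣p∣; ∣p∣≤n; x∉p⇒x∈∁p; _∈?_; p∩q⊆q; p⊂q⇒∣p∣<∣q∣;
  x∈p∩q⁻; ∣p∩q∣≤∣p∣; nonempty?; Empty-unique; ∣⊥∣≡0)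
open import Data.Vec using ([]; _∷_; lookup)
open import Data.Vec.Properties using ([]=⇒lookup; lookup⇒[]=; lookup-zipWith; lookup-map; map-∘; map-cong; map-id)
open import Data.Vec.Functional.Properties using (removeAt-punchOut)
open import Data.Product using (Σ; ∃; _×_; _,_; proj₁; proj₂)
open import Data.Sum using (_⊎_; inj₁; inj₂; map₂; [_,_]′)
open import Function using (_∘_; _⇔_; mk⇔)
open import Relation.Nullary using (¬_; Dec; yes; no; contradiction)
open import Relation.Binary using (tri<; tri≈; tri>)
open import Relation.Binary.PropositionalEquality
open import Algebra.Properties.Semiring.Sum +-*-semiring
  using (sum; sum-syntax; sum-cong-≋; sum-remove; ∑-distrib-+; ∑-comm; *-distribˡ-sum; *-distribʳ-sum;
         sum-replicate-zero)

-- Finite sums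

∑-cong : ∀ {n} {f g : Fin n → ℕ} → (∀ i → f i ≡ g i) → ∑[ i < n ] f i ≡ ∑[ i < n ] g i
∑-cong = sum-cong-≋

∑-zero : ∀ {n} {f : Fin n → ℕ} → (∀ i → f i ≡ 0) → ∑[ i < n ] f i ≡ 0
∑-zero {n} f≡0 = trans (∑-cong f≡0) (sum-replicate-zero n)

∑-single : ∀ {n} (f : Fin n → ℕ) i → (∀ j → j ≢ i → f j ≡ 0) → ∑[ j < n ] f j ≡ f i
∑-single {suc n} f i f≡0 = begin
  sum f                                   ≡⟨ sum-remove f ⟩
  f i + ∑[ j < _ ] f (punchIn i j)        ≡⟨ cong (f i +_) (∑-zero (λ j → f≡0 _ (punchInᵢ≢i i j))) ⟩
  f i + 0                                 ≡⟨ +-identityʳ (f i) ⟩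
  f i                                     ∎
  where open ≡-Reasoning

term≤∑ : ∀ {n} (f : Fin n → ℕ) i → f i ≤ ∑[ j < n ] f j
term≤∑ {suc n} f i = subst (f i ≤_) (sym (sum-remove {i = i} f)) (m≤m+n (f i) (sum (f ∘ punchIn i)))

two-terms≤∑ : ∀ {n} (f : Fin n → ℕ) {i j} → i ≢ j → f i + f j ≤ ∑[ k < n ] f k
two-terms≤∑ {suc n} f {i} {j} i≢j = subst (f i + f j ≤_) (sym (sum-remove {i = i} f))
  (+-monoʳ-≤ (f i) (subst (_≤ sum (f ∘ punchIn i)) (removeAt-punchOut f i≢j)
    (term≤∑ (f ∘ punchIn i) (punchOut i≢j))))

three-terms≤∑ : ∀ {n} (f : Fin n → ℕ) {i j k} → i ≢ j → i ≢ k → j ≢ k →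
                f i + f j + f k ≤ ∑[ l < n ] f l
three-terms≤∑ {suc n} f {i} {j} {k} i≢j i≢k j≢k =
  subst₂ _≤_ (sym (+-assoc (f i) (f j) (f k))) (sym (sum-remove {i = i} f))
    (+-monoʳ-≤ (f i) (subst (_≤ sum (f ∘ punchIn i))
      (cong₂ _+_ (removeAt-punchOut f i≢j) (removeAt-punchOut f i≢k))
      (two-terms≤∑ (f ∘ punchIn i) (j≢k ∘ punchOut-injective i≢j i≢k))))

∑-update : ∀ {n} (f g : Fin n → ℕ) i → (∀ j → j ≢ i → f j ≡ g j) →
           ∑[ j < n ] f j + g i ≡ ∑[ j < n ] g j + f i
∑-update {suc n} f g i f≡g = begin
  sum f + g i                      ≡⟨ cong (_+ g i) (sum-remove {i = i} f) ⟩
  f i + sum (f ∘ punchIn i) + g i  ≡⟨ cong (λ r → f i + r + g i) (∑-cong λ j → f≡g _ (punchInᵢ≢i i j)) ⟩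
  f i + sum (g ∘ punchIn i) + g i  ≡⟨ swap (f i) (sum (g ∘ punchIn i)) (g i) ⟩
  g i + sum (g ∘ punchIn i) + f i  ≡⟨ cong (_+ f i) (sum-remove {i = i} g) ⟨
  sum g + f i                      ∎
  where
  open ≡-Reasoning
  swap : ∀ a r b → a + r + b ≡ b + r + a
  swap = solve-∀

∑≢0⇒∃≢0 : ∀ {n} (f : Fin n → ℕ) → ∑[ i < n ] f i ≢ 0 → ∃ λ i → f i ≢ 0
∑≢0⇒∃≢0 {zero} f ∑≢0 = contradiction refl ∑≢0
∑≢0⇒∃≢0 {suc n} f ∑≢0 with f zero ≟ 0
... | no f0≢0 = zero , f0≢0
... | yes f0≡0 =
  let i , fi≢0 = ∑≢0⇒∃≢0 (f ∘ suc) (∑≢0 ∘ trans (cong (_+ sum (f ∘ suc)) f0≡0)) in suc i , fi≢0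

∑1≡n : ∀ n → ∑[ i < n ] 1 ≡ n
∑1≡n zero    = refl
∑1≡n (suc n) = cong suc (∑1≡n n)

∃-other≢0 : ∀ {n} (f : Fin n → ℕ) i → f i < ∑[ j < n ] f j → ∃ λ j → j ≢ i × f j ≢ 0
∃-other≢0 {suc n} f i fi<∑ =
  let j , fj≢0 = ∑≢0⇒∃≢0 (f ∘ punchIn i) rest≢0 in punchIn i j , punchInᵢ≢i i j , fj≢0
  where
  rest≢0 : sum (f ∘ punchIn i) ≢ 0
  rest≢0 rest≡0 =
    <-irrefl (sym (trans (sum-remove {i = i} f) (trans (cong (f i +_) rest≡0) (+-identityʳ (f i))))) fi<∑

∃-two≢0 : ∀ {n} (f : Fin n → ℕ) → (∀ i → f i ≤ 1) → 2 ≤ ∑[ i < n ] f i →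
          ∃ λ i → ∃ λ j → i ≢ j × f i ≢ 0 × f j ≢ 0
∃-two≢0 f f≤1 2≤∑ =
  let i , fi≢0 = ∑≢0⇒∃≢0 f (λ ∑≡0 → contradiction (subst (2 ≤_) ∑≡0 2≤∑) λ ())
      j , j≢i , fj≢0 = ∃-other≢0 f i (<-≤-trans (s≤s (f≤1 i)) 2≤∑)
  in i , j , j≢i ∘ sym , fi≢0 , fj≢0

∃-two-others : ∀ {n} (f : Fin n → ℕ) → (∀ i → f i ≤ 1) → 3 ≤ ∑[ i < n ] f i →
               ∀ i → ∃ λ j → ∃ λ k → j ≢ k × j ≢ i × k ≢ i × f j ≢ 0 × f k ≢ 0
∃-two-others {suc n} f f≤1 3≤∑ i =
  let j , k , j≢k , fj≢0 , fk≢0 = ∃-two≢0 (f ∘ punchIn i) (f≤1 ∘ punchIn i) 2≤rest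
  in punchIn i j , punchIn i k , j≢k ∘ punchIn-injective i j k , punchInᵢ≢i i j , punchInᵢ≢i i k , fj≢0 , fk≢0
  where
  2≤rest : 2 ≤ sum (f ∘ punchIn i)
  2≤rest = +-cancelˡ-≤ 1 2 _
             (≤-trans 3≤∑ (≤-trans (≤-reflexive (sum-remove {i = i} f)) (+-monoˡ-≤ _ (f≤1 i))))

-- Counting subsets with indicators

ι : Bool → ℕ
ι true  = 1
ι false = 0

ι≢0⇒≡true : ∀ {b} → ι b ≢ 0 → b ≡ true
ι≢0⇒≡true {true}  _    = refl
ι≢0⇒≡true {false} ι≢0 = contradiction refl ι≢0

ι*ι≢0⇒≡true : ∀ {a b} → ι a * ι b ≢ 0 → a ≡ true × b ≡ true
ι*ι≢0⇒≡true {true}  {b} ι≢0 = refl , ι≢0⇒≡true (ι≢0 ∘ trans (+-identityʳ (ι b)))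
ι*ι≢0⇒≡true {false}     ι≢0 = contradiction refl ι≢0

ι*ι≡ι : ∀ a → ι a * ι a ≡ ι a
ι*ι≡ι true  = refl
ι*ι≡ι false = refl

ι∧≡* : ∀ a b → ι (a ∧ b) ≡ ι a * ι b
ι∧≡* true  b = sym (+-identityʳ (ι b))
ι∧≡* false b = refl

∣∣≡∑ι : ∀ {n} (A : Subset n) → ∣ A ∣ ≡ ∑[ x < n ] ι (lookup A x)
∣∣≡∑ι []          = refl
∣∣≡∑ι (true ∷ A)  = cong suc (∣∣≡∑ι A)
∣∣≡∑ι (false ∷ A) = ∣∣≡∑ι A

∣∩∣≡∑ι* : ∀ {n} (A B : Subset n) → ∣ A ∩ B ∣ ≡ ∑[ x < n ] (ι (lookup A x) * ι (lookup B x))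
∣∩∣≡∑ι* A B = trans (∣∣≡∑ι (A ∩ B))
  (∑-cong λ x → trans (cong ι (lookup-zipWith _∧_ x A B)) (ι∧≡* (lookup A x) (lookup B x)))

ι*ι≤1 : ∀ a b → ι a * ι b ≤ 1
ι*ι≤1 true  true  = ≤-refl
ι*ι≤1 true  false = z≤n
ι*ι≤1 false _     = z≤n

n*ι+n*ιnot≡n : ∀ n a → n * ι a + n * ι (not a) ≡ n
n*ι+n*ιnot≡n n true  = trans (cong₂ _+_ (*-identityʳ n) (*-zeroʳ n)) (+-identityʳ n)
n*ι+n*ιnot≡n n false = cong₂ _+_ (*-zeroʳ n) (*-identityʳ n)

∣p∣≢0⇒Nonempty : ∀ {n} (p : Subset n) → ∣ p ∣ ≢ 0 → Nonempty p
∣p∣≢0⇒Nonempty {n} p ∣p∣≢0 with nonempty? p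
... | yes p≢∅ = p≢∅
... | no  p≡∅ = contradiction (trans (cong ∣_∣ (Empty-unique p≡∅)) (∣⊥∣≡0 n)) ∣p∣≢0

∣p∩q∣+∣p∩∁q∣≡∣p∣ : ∀ {n} (p q : Subset n) → ∣ p ∩ q ∣ + ∣ p ∩ ∁ q ∣ ≡ ∣ p ∣
∣p∩q∣+∣p∩∁q∣≡∣p∣ {n} p q = begin
    ∣ p ∩ q ∣ + ∣ p ∩ ∁ q ∣
  ≡⟨ cong₂ _+_ (∣∩∣≡∑ι* p q) (∣∩∣≡∑ι* p (∁ q)) ⟩
    ∑[ x < n ] (ι (lookup p x) * ι (lookup q x)) + ∑[ x < n ] (ι (lookup p x) * ι (lookup (∁ q) x))
  ≡⟨ ∑-distrib-+ (λ x → ι (lookup p x) * ι (lookup q x)) _ ⟨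
    ∑[ x < n ] (ι (lookup p x) * ι (lookup q x) + ι (lookup p x) * ι (lookup (∁ q) x))
  ≡⟨ ∑-cong (λ x → trans (cong (λ b → ι (lookup p x) * ι (lookup q x) + ι (lookup p x) * ι b) (lookup-map x not q))
                          (n*ι+n*ιnot≡n (ι (lookup p x)) (lookup q x))) ⟩
    ∑[ x < n ] ι (lookup p x)
  ≡⟨ ∣∣≡∑ι p ⟨
    ∣ p ∣ ∎
  where open ≡-Reasoning

∣p∩q∣≡∣q∣⇒q⊆p : ∀ {n} (p q : Subset n) → ∣ p ∩ q ∣ ≡ ∣ q ∣ → q ⊆ p
∣p∩q∣≡∣q∣⇒q⊆p p q ∣p∩q∣≡∣q∣ {x} x∈q with x ∈? p
... | yes x∈p = x∈p
... | no  x∉p =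
  contradiction ∣p∩q∣≡∣q∣ (<⇒≢ (p⊂q⇒∣p∣<∣q∣ (p∩q⊆q p q , x , x∈q , x∉p ∘ proj₁ ∘ x∈p∩q⁻ p q)))

∁-involutive : ∀ {n} (p : Subset n) → ∁ (∁ p) ≡ p
∁-involutive p = trans (sym (map-∘ not not p)) (trans (map-cong not-involutive p) (map-id p))

-- Projective planes

third-index : (i j : Fin 4) → ∃ λ k → i ≢ k × j ≢ k
third-index i j with i ≟F 0F | j ≟F 0F
... | no i≢0   | no j≢0   = 0F , i≢0 , j≢0
... | yes refl | _ with j ≟F 1F
...   | no j≢1   = 1F , (λ ()) , j≢1
...   | yes refl = 2F , (λ ()) , (λ ())
third-index i j | no _ | yes refl with i ≟F 1F
...   | no i≢1   = 1F , i≢1 , (λ ())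
...   | yes refl = 2F , (λ ()) , (λ ())

module Plane {q : ℕ} (Π : ProjectivePlane q) where
  open ProjectivePlane Π

  I : Fin nl → Fin np → Bool
  I l X = lookup (L l) X

  join : ∀ {P R} → P ≢ R → Fin nl
  join {P} {R} P≢R = proj₁ (joinP P R P≢R)

  join-∋ˡ : ∀ {P R} (P≢R : P ≢ R) → I (join P≢R) P ≡ true
  join-∋ˡ {P} {R} P≢R = []=⇒lookup (proj₁ (proj₁ (proj₂ (joinP P R P≢R))))

  join-∋ʳ : ∀ {P R} (P≢R : P ≢ R) → I (join P≢R) R ≡ true
  join-∋ʳ {P} {R} P≢R = []=⇒lookup (proj₂ (proj₁ (proj₂ (joinP P R P≢R))))

  join-unique : ∀ {P R l} (P≢R : P ≢ R) → I l P ≡ true → I l R ≡ true → l ≡ join P≢R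
  join-unique {P} {R} {l} P≢R P∈l R∈l =
    proj₂ (proj₂ (joinP P R P≢R)) l (lookup⇒[]= P (L l) P∈l) (lookup⇒[]= R (L l) R∈l)

  lines-through-two≡1 : ∀ {P R} → P ≢ R → ∑[ l < nl ] (ι (I l P) * ι (I l R)) ≡ 1
  lines-through-two≡1 {P} {R} P≢R =
    trans (∑-single (λ l → ι (I l P) * ι (I l R)) (join P≢R) off-join)
          (cong₂ (λ a b → ι a * ι b) (join-∋ˡ P≢R) (join-∋ʳ P≢R))
    where
    off-join : ∀ l → l ≢ join P≢R → ι (I l P) * ι (I l R) ≡ 0
    off-join l l≢join with I l P in P∈l | I l R in R∈l
    ... | true  | true  = contradiction (join-unique P≢R P∈l R∈l) l≢join
    ... | true  | false = refl
    ... | false | _     = refl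

  I⇒∈ : ∀ {l X} → I l X ≡ true → X ∈ L l
  I⇒∈ {l} {X} = lookup⇒[]= X (L l)

  ∃-line-avoiding : ∀ P → ∃ λ l → I l P ≡ false
  ∃-line-avoiding P with quad
  ... | f , distinct , noncollinear = avoid (P ≟F f 0F)
    where
    l₀₁ l₀₂ l₂₃ : Fin nl
    l₀₁ = join (distinct 0F 1F λ ())
    l₀₂ = join (distinct 0F 2F λ ())
    l₂₃ = join (distinct 2F 3F λ ())
    avoid : Dec (P ≡ f 0F) → ∃ λ l → I l P ≡ false
    avoid (yes refl) with I l₂₃ P in P∈l₂₃
    ... | false = l₂₃ , P∈l₂₃
    ... | true  = contradiction (I⇒∈ P∈l₂₃ , I⇒∈ (join-∋ˡ _) , I⇒∈ (join-∋ʳ _))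
                    (noncollinear l₂₃ 0F 2F 3F (λ ()) (λ ()) (λ ()))
    avoid (no P≢f₀) with I l₀₁ P in P∈l₀₁ | I l₀₂ P in P∈l₀₂
    ... | false | _     = l₀₁ , P∈l₀₁
    ... | true  | false = l₀₂ , P∈l₀₂
    ... | true  | true  = contradiction (I⇒∈ (join-∋ˡ _) , I⇒∈ (join-∋ʳ _) , I⇒∈ f₂∈l₀₁)
                            (noncollinear l₀₁ 0F 1F 2F (λ ()) (λ ()) (λ ()))
      where
      l₀₁≡l₀₂ : l₀₁ ≡ l₀₂
      l₀₁≡l₀₂ = trans (join-unique P≢f₀ P∈l₀₁ (join-∋ˡ _))
                      (sym (join-unique P≢f₀ P∈l₀₂ (join-∋ˡ _)))
      f₂∈l₀₁ : I l₀₁ (f 2F) ≡ true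
      f₂∈l₀₁ = subst (λ l → I l (f 2F) ≡ true) (sym l₀₁≡l₀₂) (join-∋ʳ _)

  lines-through≡ : ∀ P → ∑[ l < nl ] ι (I l P) ≡ suc q
  lines-through≡ P with ∃-line-avoiding P
  ... | l₀ , P∉l₀ = begin
      ∑[ l < nl ] ι (I l P)
    ≡⟨ ∑-cong meets-l₀ ⟨
      ∑[ l < nl ] ∑[ X < np ] (ι (I l P) * (ι (I l X) * ι (I l₀ X)))
    ≡⟨ ∑-comm (λ l X → ι (I l P) * (ι (I l X) * ι (I l₀ X))) ⟩
      ∑[ X < np ] ∑[ l < nl ] (ι (I l P) * (ι (I l X) * ι (I l₀ X)))
    ≡⟨ ∑-cong joined-to-P ⟩
      ∑[ X < np ] ι (I l₀ X)
    ≡⟨ ∣∣≡∑ι (L l₀) ⟨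
      ∣ L l₀ ∣
    ≡⟨ order l₀ ⟩
      suc q ∎
    where
    open ≡-Reasoning
    meets-l₀ : ∀ l → ∑[ X < np ] (ι (I l P) * (ι (I l X) * ι (I l₀ X))) ≡ ι (I l P)
    meets-l₀ l with I l P in P∈l
    ... | false = ∑-zero {np} λ _ → refl
    ... | true  = trans (∑-cong λ X → +-identityʳ (ι (I l X) * ι (I l₀ X)))
                    (trans (sym (∣∩∣≡∑ι* (L l) (L l₀)))
                           (meetL l l₀ λ { refl → contradiction (trans (sym P∈l) P∉l₀) λ () }))
    joined-to-P : ∀ X → ∑[ l < nl ] (ι (I l P) * (ι (I l X) * ι (I l₀ X))) ≡ ι (I l₀ X)
    joined-to-P X with I l₀ X in X∈l₀
    ... | false = ∑-zero {nl} λ l → trans (cong (ι (I l P) *_) (*-zeroʳ (ι (I l X)))) (*-zeroʳ (ι (I l P)))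
    ... | true  = trans (∑-cong λ l → cong (ι (I l P) *_) (*-identityʳ _))
                    (lines-through-two≡1 λ { refl → contradiction (trans (sym X∈l₀) P∉l₀) λ () })

  star-count : ∀ P (s : Fin np → Bool) →
    ∑[ l < nl ] (ι (I l P) * ∑[ X < np ] (ι (I l X) * ι (s X))) ≡ ∑[ X < np ] ι (s X) + q * ι (s P)
  star-count P s = +-cancelʳ-≡ (ι (s P)) _ _ (begin
      ∑[ l < nl ] (ι (I l P) * ∑[ X < np ] (ι (I l X) * ι (s X))) + ι (s P)
    ≡⟨ cong (_+ ι (s P)) (trans (∑-cong λ l → *-distribˡ-sum (ι (I l P)) (λ X → ι (I l X) * ι (s X)))
                                        (∑-comm λ l X → ι (I l P) * (ι (I l X) * ι (s X)))) ⟩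
      ∑[ X < np ] ∑[ l < nl ] (ι (I l P) * (ι (I l X) * ι (s X))) + ι (s P)
    ≡⟨ cong (_+ ι (s P)) (∑-cong λ X → trans (∑-cong λ l → sym (*-assoc (ι (I l P)) (ι (I l X)) (ι (s X))))
                                                   (sym (*-distribʳ-sum (ι (s X)) λ l → ι (I l P) * ι (I l X)))) ⟩
      ∑[ X < np ] (∑[ l < nl ] (ι (I l P) * ι (I l X)) * ι (s X)) + ι (s P)
    ≡⟨ ∑-update _ (ι ∘ s) P (λ X X≢P → trans (cong (_* ι (s X)) (lines-through-two≡1 (X≢P ∘ sym)))
                                              (*-identityˡ _)) ⟩
      ∑[ X < np ] ι (s X) + ∑[ l < nl ] (ι (I l P) * ι (I l P)) * ι (s P)
    ≡⟨ cong (λ k → ∑[ X < np ] ι (s X) + k * ι (s P))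
            (trans (∑-cong λ l → ι*ι≡ι (I l P)) (lines-through≡ P)) ⟩
      ∑[ X < np ] ι (s X) + suc q * ι (s P)
    ≡⟨ regroup (∑[ X < np ] ι (s X)) (ι (s P)) q ⟩
      ∑[ X < np ] ι (s X) + q * ι (s P) + ι (s P) ∎)
    where
    open ≡-Reasoning
    regroup : ∀ σ a q → σ + suc q * a ≡ σ + q * a + a
    regroup = solve-∀

  ∃-line-through : ∀ P → ∃ λ l → I l P ≡ true
  ∃-line-through P =
    let l , ι≢0 = ∑≢0⇒∃≢0 (λ l → ι (I l P))
                          (λ ∑≡0 → contradiction (trans (sym (lines-through≡ P)) ∑≡0) λ ())
    in l , ι≢0⇒≡true ι≢0

  at-most-two-per-line⇒GeneralPosition : (f : Fin 4 → Fin np) → (∀ l → ∑[ i < 4 ] ι (I l (f i)) ≤ 2) →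
                                          GeneralPosition L f
  at-most-two-per-line⇒GeneralPosition f ≤2 = distinct , noncollinear
    where
    noncollinear : (l : Fin nl) (i j k : Fin 4) → i ≢ j → j ≢ k → i ≢ k →
                   ¬ (f i ∈ L l × f j ∈ L l × f k ∈ L l)
    noncollinear l i j k i≢j j≢k i≢k (fi∈l , fj∈l , fk∈l) =
      contradiction (≤-trans 3≤∑ (≤2 l)) λ { (s≤s (s≤s ())) }
      where
      on : ∀ {X} → X ∈ L l → ι (I l X) ≡ 1
      on X∈l = cong ι ([]=⇒lookup X∈l)
      3≤∑ : 3 ≤ ∑[ i < 4 ] ι (I l (f i))
      3≤∑ = subst (_≤ ∑[ i < 4 ] ι (I l (f i))) (cong₂ _+_ (cong₂ _+_ (on fi∈l) (on fj∈l)) (on fk∈l))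
              (three-terms≤∑ (λ i → ι (I l (f i))) i≢j i≢k j≢k)
    distinct : (i j : Fin 4) → i ≢ j → f i ≢ f j
    distinct i j i≢j fi≡fj with third-index i j
    ... | k , i≢k , j≢k with line-through-both (f i ≟F f k)
      where
      line-through-both : Dec (f i ≡ f k) → ∃ λ l → I l (f i) ≡ true × I l (f k) ≡ true
      line-through-both (yes fi≡fk) =
        let l , fi∈l = ∃-line-through (f i) in l , fi∈l , subst (λ X → I l X ≡ true) fi≡fk fi∈l
      line-through-both (no fi≢fk) = join fi≢fk , join-∋ˡ fi≢fk , join-∋ʳ fi≢fk
    ...   | l , fi∈l , fk∈l = noncollinear l i j k i≢j j≢k i≢k
      (I⇒∈ fi∈l , I⇒∈ (subst (λ X → I l X ≡ true) fi≡fj fi∈l) , I⇒∈ fk∈l)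

  points+q≡ : np + q ≡ suc q * suc q
  points+q≡ = begin
      np + q
    ≡⟨ cong₂ _+_ (∑1≡n np) (*-identityʳ q) ⟨
      ∑[ X < np ] ι true + q * ι true
    ≡⟨ star-count P (λ _ → true) ⟨
      ∑[ l < nl ] (ι (I l P) * ∑[ X < np ] (ι (I l X) * 1))
    ≡⟨ ∑-cong (λ l → cong (ι (I l P) *_) line-size) ⟩
      ∑[ l < nl ] (ι (I l P) * suc q)
    ≡⟨ *-distribʳ-sum (suc q) (λ l → ι (I l P)) ⟨
      ∑[ l < nl ] ι (I l P) * suc q
    ≡⟨ cong (_* suc q) (lines-through≡ P) ⟩
      suc q * suc q ∎
    where
    open ≡-Reasoning
    P : Fin np
    P = proj₁ quad 0F
    line-size : ∀ {l} → ∑[ X < np ] (ι (I l X) * 1) ≡ suc q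
    line-size {l} = trans (∑-cong λ X → *-identityʳ (ι (I l X))) (trans (sym (∣∣≡∑ι (L l))) (order l))

  ι-pair≤1 : ∀ {l₀ P P′} → P ≢ P′ → I l₀ P ≡ true → I l₀ P′ ≡ true →
             ∀ {l} → l ≢ l₀ → ι (I l P) + ι (I l P′) ≤ 1
  ι-pair≤1 {l₀} {P} {P′} P≢P′ P∈l₀ P′∈l₀ {l} l≢l₀ with I l P in P∈l | I l P′ in P′∈l
  ... | true  | true  =
    contradiction (trans (join-unique P≢P′ P∈l P′∈l) (sym (join-unique P≢P′ P∈l₀ P′∈l₀))) l≢l₀
  ... | true  | false = ≤-refl
  ... | false | true  = ≤-refl
  ... | false | false = z≤n

  off-second-line : ∀ {l₁ l₂ P X} → l₁ ≢ l₂ → I l₁ P ≡ true → I l₂ P ≡ true →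
                    I l₁ X ≡ true → X ≢ P → I l₂ X ≡ false
  off-second-line {l₁} {l₂} {P} {X} l₁≢l₂ P∈l₁ P∈l₂ X∈l₁ X≢P with I l₂ X in X∈l₂
  ... | false = refl
  ... | true  = contradiction (trans (join-unique X≢P X∈l₁ P∈l₁) (sym (join-unique X≢P X∈l₂ P∈l₂))) l₁≢l₂

  ⟨_,_,_,_⟩ : Fin np → Fin np → Fin np → Fin np → Fin 4 → Fin np
  ⟨ A , A′ , B , B′ ⟩ 0F = A
  ⟨ A , A′ , B , B′ ⟩ 1F = A′
  ⟨ A , A′ , B , B′ ⟩ 2F = B
  ⟨ A , A′ , B , B′ ⟩ 3F = B′

  quadrangle : ∀ {l₁ l₂ A A′ B B′} → l₁ ≢ l₂ →
    A ≢ A′ → I l₁ A ≡ true → I l₁ A′ ≡ true → I l₂ A ≡ false → I l₂ A′ ≡ false →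
    B ≢ B′ → I l₂ B ≡ true → I l₂ B′ ≡ true → I l₁ B ≡ false → I l₁ B′ ≡ false →
    GeneralPosition L ⟨ A , A′ , B , B′ ⟩
  quadrangle {l₁} {l₂} {A} {A′} {B} {B′}
             l₁≢l₂ A≢A′ A∈l₁ A′∈l₁ A∉l₂ A′∉l₂ B≢B′ B∈l₂ B′∈l₂ B∉l₁ B′∉l₁ =
    at-most-two-per-line⇒GeneralPosition _ at-most-two
    where
    at-most-two : ∀ l → ι (I l A) + (ι (I l A′) + (ι (I l B) + (ι (I l B′) + 0))) ≤ 2
    at-most-two l with l ≟F l₁ | l ≟F l₂
    ... | yes refl | _        rewrite A∈l₁ | A′∈l₁ | B∉l₁ | B′∉l₁ = ≤-refl
    ... | no _     | yes refl rewrite A∉l₂ | A′∉l₂ | B∈l₂ | B′∈l₂ = ≤-refl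
    ... | no l≢l₁  | no l≢l₂  =
      subst (_≤ 2) (regroup (ι (I l A)) (ι (I l A′)) (ι (I l B)) (ι (I l B′)))
        (+-mono-≤ (ι-pair≤1 A≢A′ A∈l₁ A′∈l₁ l≢l₁) (ι-pair≤1 B≢B′ B∈l₂ B′∈l₂ l≢l₂))
      where
      regroup : ∀ a a′ b b′ → a + a′ + (b + b′) ≡ a + (a′ + (b + (b′ + 0)))
      regroup = solve-∀

-- Prime powers

∣p^k⇒≡p^a : ∀ {p} → Prime p → ∀ k {d} → d ∣ p ^ k → ∃ λ a → d ≡ p ^ a
∣p^k⇒≡p^a pr zero    d∣1 = 0 , ∣1⇒≡1 d∣1
∣p^k⇒≡p^a {p} pr (suc k) {d} (divides c pᵏ⁺¹≡cd)
  with euclidsLemma c d pr (divides (p ^ k) (trans (sym pᵏ⁺¹≡cd) (*-comm p (p ^ k))))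
... | inj₁ (divides c′ refl) =
  ∣p^k⇒≡p^a pr k (divides c′ (*-cancelˡ-≡ (p ^ k) (c′ * d) p (trans pᵏ⁺¹≡cd (reassoc c′ p d))))
  where
  instance _ = prime⇒nonZero pr
  reassoc : ∀ c p d → c * p * d ≡ p * (c * d)
  reassoc = solve-∀
... | inj₂ (divides d′ refl) =
  let a , d′≡pᵃ = ∣p^k⇒≡p^a pr k (*-cancelˡ-∣ p (subst (_∣ p * p ^ k) (*-comm d′ p) (divides c pᵏ⁺¹≡cd)))
  in suc a , trans (*-comm d′ p) (cong (p *_) d′≡pᵃ)
  where instance _ = prime⇒nonZero pr

coprime-p^a : ∀ {p y} → Prime p → ¬ p ∣ y → ∀ a → Coprime (p ^ a) y
coprime-p^a {p} pr p∤y a (i∣pᵃ , i∣y) with ∣p^k⇒≡p^a pr a i∣pᵃ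
... | zero  , i≡1  = i≡1
... | suc b , refl = contradiction (∣-trans (m∣m*n (p ^ b)) i∣y) p∤y

a+bd≡1+cd⇒a≡1 : ∀ {a b c d} → 2 ≤ d → a < d → a + b * d ≡ 1 + c * d → a ≡ 1
a+bd≡1+cd⇒a≡1 {a} {b} {c} {d} 2≤d a<d eq = begin
    a               ≡⟨ m<n⇒m%n≡m a<d ⟨
    a % d           ≡⟨ [m+kn]%n≡m%n a b d ⟨
    (a + b * d) % d ≡⟨ cong (_% d) eq ⟩
    (1 + c * d) % d ≡⟨ [m+kn]%n≡m%n 1 c d ⟩
    1 % d           ≡⟨ m<n⇒m%n≡m 2≤d ⟩
    1               ∎
  where
  open ≡-Reasoning
  instance _ = >-nonZero (<-trans (s≤s z≤n) 2≤d)

d∣t⇒t′≡1∧d*d≡q : ∀ {d t t′ q} → 2 ≤ d → d ∣ t → d ∣ q →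
                     t * t′ + d ≡ d * d → t + t′ + d ≡ suc q → t′ ≡ 1 × d * d ≡ q
d∣t⇒t′≡1∧d*d≡q {d} {_} {t′} 2≤d (divides x refl) (divides y refl) product sum = t′≡1 , dd≡q
  where
  instance _ = >-nonZero (<-trans (s≤s z≤n) 2≤d)
  xt′+1≡d : x * t′ + 1 ≡ d
  xt′+1≡d = *-cancelʳ-≡ (x * t′ + 1) d d (trans (regroup x t′ d) product)
    where
    regroup : ∀ x t′ d → (x * t′ + 1) * d ≡ x * d * t′ + d
    regroup = solve-∀
  x≢0 : x ≢ 0
  x≢0 refl = contradiction (subst (2 ≤_) (sym xt′+1≡d) 2≤d) λ { (s≤s ()) }
  t′<d : t′ < d
  t′<d = subst (t′ <_) (trans (+-comm 1 (x * t′)) xt′+1≡d) (s≤s (m≤n*m t′ x {{≢-nonZero x≢0}}))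
  t′≡1 : t′ ≡ 1
  t′≡1 = a+bd≡1+cd⇒a≡1 {b = suc x} {c = y} 2≤d t′<d (trans (regroup x d t′) sum)
    where
    regroup : ∀ x d t′ → t′ + suc x * d ≡ x * d + t′ + d
    regroup = solve-∀
  dd≡q : d * d ≡ y * d
  dd≡q = suc-injective (begin
    suc (d * d)             ≡⟨ cong (λ e → suc (e * d)) xt′+1≡d ⟨
    suc ((x * t′ + 1) * d)  ≡⟨ cong (λ t′ → suc ((x * t′ + 1) * d)) t′≡1 ⟩
    suc ((x * 1 + 1) * d)   ≡⟨ regroup x d ⟩
    x * d + 1 + d           ≡⟨ cong (λ t′ → x * d + t′ + d) t′≡1 ⟨
    x * d + t′ + d          ≡⟨ sum ⟩
    suc (y * d)             ∎)
    where
    open ≡-Reasoning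
    regroup : ∀ x d → suc ((x * 1 + 1) * d) ≡ x * d + 1 + d
    regroup = solve-∀

m*n+d≡d*d⇒d∣m*n : ∀ m n {d} → m * n + d ≡ d * d → d ∣ m * n
m*n+d≡d*d⇒d∣m*n m n {d} eq = ∣m+n∣m⇒∣n (subst (d ∣_) (trans (sym eq) (+-comm (m * n) d)) (m∣m*n d)) ∣-refl

prime-power-divisor-square : ∀ {q d t t′} → IsPrimePower q → 2 ≤ d → d ∣ q →
  t * t′ + d ≡ d * d → t + t′ + d ≡ suc q → d * d ≡ q × (t ≡ 1 ⊎ t′ ≡ 1)
prime-power-divisor-square {q} {d} {t} {t′} (p , k , pr , q≡pᵏ⁺¹) 2≤d d∣q product sum
  with ∣p^k⇒≡p^a pr (suc k) (subst (d ∣_) q≡pᵏ⁺¹ d∣q)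
... | zero  , refl = contradiction 2≤d λ { (s≤s ()) }
... | suc a , refl with p ∣? t | p ∣? t′
... | _      | no p∤t′ =
  let t′≡1 , dd≡q = d∣t⇒t′≡1∧d*d≡q 2≤d
                      (coprime-divisor (coprime-p^a pr p∤t′ (suc a))
                                       (subst (d ∣_) (*-comm t t′) (m*n+d≡d*d⇒d∣m*n t t′ product)))
                      d∣q product sum
  in dd≡q , inj₂ t′≡1
... | no p∤t | yes _   =
  let t≡1 , dd≡q = d∣t⇒t′≡1∧d*d≡q 2≤d
                     (coprime-divisor (coprime-p^a pr p∤t (suc a)) (m*n+d≡d*d⇒d∣m*n t t′ product)) d∣q
                     (trans (cong (_+ d) (*-comm t′ t)) product) (trans (cong (_+ d) (+-comm t′ t)) sum)
  in dd≡q , inj₁ t≡1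
... | yes p∣t | yes p∣t′ = contradiction (subst Prime (∣1⇒≡1 p∣1) pr) ¬prime[1]
  where
  p∣q : p ∣ q
  p∣q = subst (p ∣_) (sym q≡pᵏ⁺¹) (m∣m*n (p ^ k))
  p∣q+1 : p ∣ q + 1
  p∣q+1 = subst (p ∣_) (trans sum (+-comm 1 q)) (∣m∣n⇒∣m+n (∣m∣n⇒∣m+n p∣t p∣t′) (m∣m*n (p ^ a)))
  p∣1 : p ∣ 1
  p∣1 = ∣m+n∣m⇒∣n p∣q+1 p∣q

prime-power≥2 : ∀ {q} → IsPrimePower q → 2 ≤ q
prime-power≥2 (p , k , pr , refl) =
  ≤-trans (nonTrivial⇒n>1 p {{prime⇒nonTrivial pr}}) (m≤m*n p (p ^ k) {{m^n≢0 p k {{prime⇒nonZero pr}}}})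

-- Arithmetic of the counting identities

star-arithmetic : ∀ {q m t a b k σ} → a + b ≡ suc q → m * a + t * b + k ≡ σ + q → σ + q ≡ q * m + t →
                  m + t * b + k ≡ m * b + t
star-arithmetic {q} {m} {t} {a} {b} {k} {σ} a+b star size = +-cancelʳ-≡ (m * a) _ _ (begin
  m + t * b + k + m * a  ≡⟨ regroup m t a b k ⟩
  m * a + t * b + k + m  ≡⟨ cong (_+ m) (trans star size) ⟩
  q * m + t + m          ≡⟨ expand q m t ⟩
  m * suc q + t          ≡⟨ cong (λ n → m * n + t) a+b ⟨
  m * (a + b) + t        ≡⟨ distribute m a b t ⟩
  m * b + t + m * a      ∎)
  where
  open ≡-Reasoning
  regroup : ∀ m t a b k → m + t * b + k + m * a ≡ m * a + t * b + k + m
  regroup = solve-∀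
  expand : ∀ q m t → q * m + t + m ≡ m * suc q + t
  expand = solve-∀
  distribute : ∀ m a b t → m * (a + b) + t ≡ m * b + t + m * a
  distribute = solve-∀

m≡t⇒q≡0 : ∀ {m q b} → m + m * b + q ≡ m * b + m → q ≡ 0
m≡t⇒q≡0 {m} {q} {b} eq = +-cancelˡ-≡ (m * b + m) q 0 (trans (regroup m b q) (trans eq (sym (+-identityʳ _))))
  where
  regroup : ∀ m b q → m * b + m + q ≡ m + m * b + q
  regroup = solve-∀

m≢t⇒b≡1 : ∀ {m t b} → m + t * b + 0 ≡ m * b + t → m ≢ t → b ≡ 1
m≢t⇒b≡1 {m} {t} {zero} eq m≢t = contradiction (trans (regroup₁ m t) (trans eq (regroup₂ m t))) m≢t
  where
  regroup₁ : ∀ m t → m ≡ m + t * 0 + 0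
  regroup₁ = solve-∀
  regroup₂ : ∀ m t → m * 0 + t ≡ t
  regroup₂ = solve-∀
m≢t⇒b≡1 {b = suc zero} _ _ = refl
m≢t⇒b≡1 {m} {t} {suc (suc b)} eq m≢t = contradiction (sym (*-cancelʳ-≡ t m (suc b) t*b≡m*b)) m≢t
  where
  t*b≡m*b : t * suc b ≡ m * suc b
  t*b≡m*b = +-cancelʳ-≡ (m + t) _ _ (trans (regroup₁ m t b) (trans eq (regroup₂ m t b)))
    where
    regroup₁ : ∀ m t b → t * suc b + (m + t) ≡ m + t * suc (suc b) + 0
    regroup₁ = solve-∀
    regroup₂ : ∀ m t b → m * suc (suc b) + t ≡ m * suc b + (m + t)
    regroup₂ = solve-∀

m<t⇒b≡0 : ∀ {m t b q} → m + t * b + q ≡ m * b + t → m < t → 1 ≤ q → b ≡ 0 × t ≡ m + q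
m<t⇒b≡0 {m} {t} {b} {q} eq m<t 1≤q with m≤n⇒∃[o]m+o≡n m<t
... | o , refl = b≡0 , trans (sym (+-suc m o)) (cong (m +_) (sym q≡e))
  where
  e : ℕ
  e = suc o
  eb+q≡e : e * b + q ≡ e
  eb+q≡e = +-cancelˡ-≡ (m + m * b) _ _ (trans (regroup₁ m o b q) (trans eq (regroup₂ m o b)))
    where
    regroup₁ : ∀ m o b q → m + m * b + (suc o * b + q) ≡ m + (suc m + o) * b + q
    regroup₁ = solve-∀
    regroup₂ : ∀ m o b → m * b + (suc m + o) ≡ m + m * b + suc o
    regroup₂ = solve-∀
  b≡0 : b ≡ 0
  b≡0 = n<1⇒n≡0 (*-cancelˡ-< e b 1 (subst (_≤ e * 1) (+-comm (e * b) 1)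
          (≤-trans (+-monoʳ-≤ (e * b) 1≤q) (≤-reflexive (trans eb+q≡e (sym (*-identityʳ e)))))))
  q≡e : q ≡ e
  q≡e = trans (cong (_+ q) (sym (*-zeroʳ e))) (trans (cong (λ b → e * b + q) (sym b≡0)) eb+q≡e)

m≡t+d⇒d*b≡d+q : ∀ {m t b q d} → m + t * b + q ≡ m * b + t → m ≡ t + d → d * b ≡ d + q
m≡t+d⇒d*b≡d+q {m} {t} {b} {q} {d} eq refl =
  +-cancelˡ-≡ (t + t * b) _ _ (trans (regroup₁ t b d) (trans (sym eq) (regroup₂ t b d q)))
  where
  regroup₁ : ∀ t b d → t + t * b + d * b ≡ (t + d) * b + t
  regroup₁ = solve-∀
  regroup₂ : ∀ t b d q → t + d + t * b + q ≡ t + t * b + (d + q)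
  regroup₂ = solve-∀

double-count-arithmetic : ∀ {q t t′ d′ T W σ κ N} → let d = suc d′ in
  1 ≤ q → t + t′ + d ≡ suc q → σ + q ≡ q * (t + d) + t → N + q ≡ suc q * suc q → σ + κ ≡ N →
  σ ≡ t * T → t * T + W ≡ T * suc q → d * W ≡ (d + q) * κ →
  t * t′ + d ≡ d * d
double-count-arithmetic {q} {t} {t′} {d′} {T} {W} {σ} {κ} {N} 1≤q sum size points partition σ≡tT tT+W dW =
  finish q≡ σ≡ N≡ 1≤q key partition
  where
  d : ℕ
  d = suc d′
  q≡ : q ≡ t + t′ + d′
  q≡ = suc-injective (trans (sym sum) (+-suc (t + t′) d′))
  W≡ : W ≡ T * (t′ + d)
  W≡ = +-cancelˡ-≡ (t * T) _ _ (trans tT+W (trans (cong (T *_) (sym sum)) (regroup t t′ d T)))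
    where
    regroup : ∀ t t′ d T → T * (t + t′ + d) ≡ t * T + T * (t′ + d)
    regroup = solve-∀
  key : d * σ * (t′ + d) ≡ t * (d + q) * κ
  key = begin
    d * σ * (t′ + d)        ≡⟨ cong (λ σ → d * σ * (t′ + d)) σ≡tT ⟩
    d * (t * T) * (t′ + d)  ≡⟨ regroup d t T (t′ + d) ⟩
    t * (d * (T * (t′ + d))) ≡⟨ cong (λ W → t * (d * W)) W≡ ⟨
    t * (d * W)             ≡⟨ cong (t *_) dW ⟩
    t * ((d + q) * κ)       ≡⟨ *-assoc t (d + q) κ ⟨
    t * (d + q) * κ         ∎
    where
    open ≡-Reasoning
    regroup : ∀ d t T u → d * (t * T) * u ≡ t * (d * (T * u))
    regroup = solve-∀
  σ≡ : σ ≡ q * (t + d′) + t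
  σ≡ = +-cancelʳ-≡ q _ _ (trans size (regroup q t d′))
    where
    regroup : ∀ q t d′ → q * (t + suc d′) + t ≡ q * (t + d′) + t + q
    regroup = solve-∀
  N≡ : N ≡ q * q + q + 1
  N≡ = +-cancelʳ-≡ q _ _ (trans points (regroup q))
    where
    regroup : ∀ q → suc q * suc q ≡ q * q + q + 1 + q
    regroup = solve-∀
  finish : ∀ {q σ N} → q ≡ t + t′ + d′ → σ ≡ q * (t + d′) + t → N ≡ q * q + q + 1 → 1 ≤ q →
           d * σ * (t′ + d) ≡ t * (d + q) * κ → σ + κ ≡ N → t * t′ + d ≡ d * d
  finish {q} {σ} {N} refl refl refl 1≤q key partition = trans (cong (_+ d) tt′≡dd′) (regroup d′)
    where
    instance _ = >-nonZero (*-mono-≤ 1≤q (s≤s (z≤n {q})))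
    -- With q, σ and N eliminated, the two double counts combine into this polynomial identity,
    -- from which the factor q (q + 1) cancels.
    identity : ∀ t t′ d′ → let d = suc d′ ; q = t + t′ + d′ ; σ = q * (t + d′) + t ; N = q * q + q + 1 in
      d * σ * (t′ + d) + q * suc q * (t * t′) + t * (d + q) * σ ≡ t * (d + q) * N + q * suc q * (d * d′)
    identity = solve-∀
    tt′≡dd′ : t * t′ ≡ d * d′
    tt′≡dd′ = *-cancelˡ-≡ (t * t′) (d * d′) (q * suc q) (+-cancelˡ-≡ (t * (d + q) * N) _ _ (begin
      t * (d + q) * N + q * suc q * (t * t′)
        ≡⟨ cong (λ N → t * (d + q) * N + q * suc q * (t * t′)) partition ⟨
      t * (d + q) * (σ + κ) + q * suc q * (t * t′)
        ≡⟨ regroup′ (t * (d + q)) σ κ (q * suc q * (t * t′)) ⟩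
      t * (d + q) * κ + q * suc q * (t * t′) + t * (d + q) * σ
        ≡⟨ cong (λ x → x + q * suc q * (t * t′) + t * (d + q) * σ) key ⟨
      d * σ * (t′ + d) + q * suc q * (t * t′) + t * (d + q) * σ
        ≡⟨ identity t t′ d′ ⟩
      t * (d + q) * N + q * suc q * (d * d′) ∎))
      where
      open ≡-Reasoning
      regroup′ : ∀ a b c e → a * (b + c) + e ≡ a * c + e + a * b
      regroup′ = solve-∀
    regroup : ∀ d′ → suc d′ * d′ + suc d′ ≡ suc d′ * suc d′
    regroup = solve-∀

-- Generalized KM-arcs without 0-secants

module KMArc {q : ℕ} (2≤q : 2 ≤ q) (Π : ProjectivePlane q) {S : Subset (ProjectivePlane.np Π)} {m t : ℕ}
             (arc : IsGenKMArc Π S m t) (no0 : NoZeroSecant Π S) where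
  open ProjectivePlane Π
  open Plane Π

  s : Fin np → Bool
  s = lookup S

  Collinear Unital Baer-complement Point-complement : Set
  Collinear = m ≡ 1 × IsCollinearQ+1 Π S
  Unital = Σ ℕ λ r → r * r ≡ q × t ≡ 1 × m ≡ r + 1 × IsUnital Π r S
  Baer-complement = Σ ℕ λ r → r * r ≡ q × t ≡ q ∸ r × m ≡ q × Σ (Subset np) λ B → S ≡ ∁ B × IsSubplane Π r B
  Point-complement = t ≡ q × m ≡ suc q × Σ (Fin np) λ p → (x : Fin np) → (x ∈ S ⇔ x ≢ p)

  size : ∣ S ∣ + q ≡ q * m + t
  size = proj₁ (proj₂ (proj₂ arc))

  secant : ∀ l → ∣ L l ∩ S ∣ ≡ m ⊎ ∣ L l ∩ S ∣ ≡ t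
  secant l with proj₂ (proj₂ (proj₂ arc)) l
  ... | inj₁ ∣l∩S∣≡0   = contradiction ∣l∩S∣≡0 (no0 l)
  ... | inj₂ ∣l∩S∣≡m⊎t = ∣l∩S∣≡m⊎t

  isM : Fin nl → Bool
  isM l = ∣ L l ∩ S ∣ ≡ᵇ m

  m-line : ∀ {l} → isM l ≡ true → ∣ L l ∩ S ∣ ≡ m
  m-line {l} isM≡true = ≡ᵇ⇒≡ ∣ L l ∩ S ∣ m (subst T (sym isM≡true) tt)

  t-line : ∀ {l} → isM l ≡ false → ∣ L l ∩ S ∣ ≡ t
  t-line {l} isM≡false with secant l
  ... | inj₁ ∣l∩S∣≡m = contradiction (subst T isM≡false (≡⇒≡ᵇ ∣ L l ∩ S ∣ m ∣l∩S∣≡m)) λ ()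
  ... | inj₂ ∣l∩S∣≡t = ∣l∩S∣≡t

  secant≡ : ∀ l → ∣ L l ∩ S ∣ ≡ m * ι (isM l) + t * ι (not (isM l))
  secant≡ l with isM l in isM≡
  ... | true  = trans (m-line isM≡) (sym (trans (cong₂ _+_ (*-identityʳ m) (*-zeroʳ t)) (+-identityʳ m)))
  ... | false = trans (t-line isM≡) (sym (cong₂ _+_ (*-zeroʳ m) (*-identityʳ t)))

  m-lines t-lines : Fin np → ℕ
  m-lines P = ∑[ l < nl ] (ι (I l P) * ι (isM l))
  t-lines P = ∑[ l < nl ] (ι (I l P) * ι (not (isM l)))

  m-lines+t-lines≡ : ∀ P → m-lines P + t-lines P ≡ suc q
  m-lines+t-lines≡ P = trans (sym (∑-distrib-+ (λ l → ι (I l P) * ι (isM l)) _))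
                             (trans (∑-cong λ l → n*ι+n*ιnot≡n (ι (I l P)) (isM l)) (lines-through≡ P))

  secants-through : ∀ P → m * m-lines P + t * t-lines P ≡ ∑[ l < nl ] (ι (I l P) * ∣ L l ∩ S ∣)
  secants-through P = begin
      m * m-lines P + t * t-lines P
    ≡⟨ cong₂ _+_ (*-distribˡ-sum m (λ l → ι (I l P) * ι (isM l)))
                 (*-distribˡ-sum t (λ l → ι (I l P) * ι (not (isM l)))) ⟩
      ∑[ l < nl ] (m * (ι (I l P) * ι (isM l))) + ∑[ l < nl ] (t * (ι (I l P) * ι (not (isM l))))
    ≡⟨ ∑-distrib-+ (λ l → m * (ι (I l P) * ι (isM l))) (λ l → t * (ι (I l P) * ι (not (isM l)))) ⟨
      ∑[ l < nl ] (m * (ι (I l P) * ι (isM l)) + t * (ι (I l P) * ι (not (isM l))))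
    ≡⟨ ∑-cong (λ l → trans (regroup m t (ι (I l P)) (ι (isM l)) (ι (not (isM l))))
                           (cong (ι (I l P) *_) (sym (secant≡ l)))) ⟩
      ∑[ l < nl ] (ι (I l P) * ∣ L l ∩ S ∣) ∎
    where
    open ≡-Reasoning
    regroup : ∀ m t a b c → m * (a * b) + t * (a * c) ≡ a * (m * b + t * c)
    regroup = solve-∀

  star : ∀ P → m * m-lines P + t * t-lines P + q * ι (not (s P)) ≡ ∣ S ∣ + q
  star P = begin
      m * m-lines P + t * t-lines P + q * ι (not (s P))
    ≡⟨ cong (_+ q * ι (not (s P)))
            (trans (secants-through P) (∑-cong λ l → cong (ι (I l P) *_) (∣∩∣≡∑ι* (L l) S))) ⟩
      ∑[ l < nl ] (ι (I l P) * ∑[ X < np ] (ι (I l X) * ι (s X))) + q * ι (not (s P))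
    ≡⟨ cong (_+ q * ι (not (s P))) (star-count P s) ⟩
      ∑[ X < np ] ι (s X) + q * ι (s P) + q * ι (not (s P))
    ≡⟨ +-assoc (∑[ X < np ] ι (s X)) (q * ι (s P)) (q * ι (not (s P))) ⟩
      ∑[ X < np ] ι (s X) + (q * ι (s P) + q * ι (not (s P)))
    ≡⟨ cong₂ _+_ (sym (∣∣≡∑ι S)) (n*ι+n*ιnot≡n q (s P)) ⟩
      ∣ S ∣ + q ∎
    where open ≡-Reasoning

  star-identity : ∀ P → m + t * t-lines P + q * ι (not (s P)) ≡ m * t-lines P + t
  star-identity P = star-arithmetic (m-lines+t-lines≡ P) (star P) size

  P₀ Q₀ : Fin np
  P₀ = proj₁ (proj₁ arc)
  Q₀ = proj₁ (proj₁ (proj₂ arc))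

  P₀∈S : s P₀ ≡ true
  P₀∈S = []=⇒lookup (proj₂ (proj₁ arc))

  Q₀∉S : s Q₀ ≡ false
  Q₀∉S = not-injective (trans (sym (lookup-map Q₀ not S)) ([]=⇒lookup (proj₂ (proj₁ (proj₂ arc)))))

  identity-inside : ∀ {P} → s P ≡ true → m + t * t-lines P + 0 ≡ m * t-lines P + t
  identity-inside {P} P∈S =
    trans (cong (m + t * t-lines P +_) (sym (trans (cong (λ b → q * ι (not b)) P∈S) (*-zeroʳ q))))
          (star-identity P)

  identity-outside : ∀ {Q} → s Q ≡ false → m + t * t-lines Q + q ≡ m * t-lines Q + t
  identity-outside {Q} Q∉S =
    trans (cong (m + t * t-lines Q +_) (sym (trans (cong (λ b → q * ι (not b)) Q∉S) (*-identityʳ q))))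
          (star-identity Q)

  m≢t : m ≢ t
  m≢t refl = contradiction (subst (2 ≤_) (m≡t⇒q≡0 {m} {q} {t-lines Q₀} (identity-outside Q₀∉S)) 2≤q) λ ()

  t-lines≡1 : ∀ {P} → s P ≡ true → t-lines P ≡ 1
  t-lines≡1 P∈S = m≢t⇒b≡1 (identity-inside P∈S) m≢t

  ∃-t-line : ∀ {P} → t-lines P ≢ 0 → ∃ λ l → I l P ≡ true × isM l ≡ false
  ∃-t-line {P} ≢0 with ∑≢0⇒∃≢0 (λ l → ι (I l P) * ι (not (isM l))) ≢0
  ... | l , ≢0′ = let P∈l , isT = ι*ι≢0⇒≡true ≢0′ in l , P∈l , not-injective isT

  ∃-m-line : ∀ {P} → m-lines P ≢ 0 → ∃ λ l → I l P ≡ true × isM l ≡ true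
  ∃-m-line {P} ≢0 with ∑≢0⇒∃≢0 (λ l → ι (I l P) * ι (isM l)) ≢0
  ... | l , ≢0′ = l , ι*ι≢0⇒≡true ≢0′

  secant≤ : ∀ l → ∣ L l ∩ S ∣ ≤ suc q
  secant≤ l = subst (∣ L l ∩ S ∣ ≤_) (order l) (∣p∩q∣≤∣p∣ (L l) S)

  t-line-through : ∀ {P} → s P ≡ true → ∃ λ l → I l P ≡ true × isM l ≡ false
  t-line-through P∈S = ∃-t-line λ t-lines≡0 → contradiction (trans (sym (t-lines≡1 P∈S)) t-lines≡0) λ ()

  m-line-through-P₀ : ∃ λ l → I l P₀ ≡ true × isM l ≡ true
  m-line-through-P₀ = ∃-m-line λ m-lines≡0 → contradiction (subst (2 ≤_) (trans m-lines≡q m-lines≡0) 2≤q) λ ()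
    where
    m-lines≡q : q ≡ m-lines P₀
    m-lines≡q = +-cancelʳ-≡ 1 _ _
      (trans (+-comm q 1) (trans (sym (m-lines+t-lines≡ P₀)) (cong (m-lines P₀ +_) (t-lines≡1 P₀∈S))))

  t-realised : ∃ λ l → ∣ L l ∩ S ∣ ≡ t
  t-realised = let l , _ , isT = t-line-through P₀∈S in l , t-line isT

  m-realised : ∃ λ l → ∣ L l ∩ S ∣ ≡ m
  m-realised = let l , _ , isM≡ = m-line-through-P₀ in l , m-line isM≡

  m≢0 : m ≢ 0
  m≢0 = let l , ∣l∩S∣≡m = m-realised in no0 l ∘ trans ∣l∩S∣≡m

  t≢0 : t ≢ 0
  t≢0 = let l , ∣l∩S∣≡t = t-realised in no0 l ∘ trans ∣l∩S∣≡t

  m≤1+q : m ≤ suc q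
  m≤1+q = let l , ∣l∩S∣≡m = m-realised in subst (_≤ suc q) ∣l∩S∣≡m (secant≤ l)

  t≤1+q : t ≤ suc q
  t≤1+q = let l , ∣l∩S∣≡t = t-realised in subst (_≤ suc q) ∣l∩S∣≡t (secant≤ l)

  collinear-case : m < t → Collinear
  collinear-case m<t =
    let l , _ , isT = t-line-through P₀∈S
    in m≡1 , ∣S∣≡1+q , l , ∣p∩q∣≡∣q∣⇒q⊆p (L l) S (trans (t-line isT) (trans t≡1+q (sym ∣S∣≡1+q)))
    where
    t≡m+q : t ≡ m + q
    t≡m+q = proj₂ (m<t⇒b≡0 (identity-outside Q₀∉S) m<t (≤-trans (s≤s z≤n) 2≤q))
    m≡1 : m ≡ 1
    m≡1 = ≤-antisym (+-cancelʳ-≤ q m 1 (subst (_≤ suc q) t≡m+q t≤1+q)) (n≢0⇒n>0 m≢0)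
    t≡1+q : t ≡ suc q
    t≡1+q = trans t≡m+q (cong (_+ q) m≡1)
    ∣S∣≡1+q : ∣ S ∣ ≡ suc q
    ∣S∣≡1+q = +-cancelʳ-≡ q _ _ (trans size (trans (cong₂ (λ m t → q * m + t) m≡1 t≡1+q) (regroup q)))
      where
      regroup : ∀ q → q * 1 + suc q ≡ suc q + q
      regroup = solve-∀

  cosecant≡ : ∀ l → ∣ L l ∩ S ∣ + ∣ L l ∩ ∁ S ∣ ≡ suc q
  cosecant≡ l = trans (∣p∩q∣+∣p∩∁q∣≡∣p∣ (L l) S) (order l)

  ∣S∣+∣∁S∣≡np : ∣ S ∣ + ∣ ∁ S ∣ ≡ np
  ∣S∣+∣∁S∣≡np = trans (cong (∣ S ∣ +_) (∣∁p∣≡n∸∣p∣ S)) (m+[n∸m]≡n (∣p∣≤n S))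

  t-line-count : ℕ
  t-line-count = ∑[ l < nl ] ι (not (isM l))

  ∑-t-lines : ∀ (g : Fin np → ℕ) →
    ∑[ X < np ] (g X * t-lines X) ≡ ∑[ l < nl ] (ι (not (isM l)) * ∑[ X < np ] (ι (I l X) * g X))
  ∑-t-lines g = begin
      ∑[ X < np ] (g X * t-lines X)
    ≡⟨ ∑-cong (λ X → *-distribˡ-sum (g X) (λ l → ι (I l X) * ι (not (isM l)))) ⟩
      ∑[ X < np ] ∑[ l < nl ] (g X * (ι (I l X) * ι (not (isM l))))
    ≡⟨ ∑-comm (λ X l → g X * (ι (I l X) * ι (not (isM l)))) ⟩
      ∑[ l < nl ] ∑[ X < np ] (g X * (ι (I l X) * ι (not (isM l))))
    ≡⟨ ∑-cong (λ l → trans (∑-cong λ X → regroup (g X) (ι (I l X)) (ι (not (isM l))))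
                          (sym (*-distribˡ-sum (ι (not (isM l))) (λ X → ι (I l X) * g X)))) ⟩
      ∑[ l < nl ] (ι (not (isM l)) * ∑[ X < np ] (ι (I l X) * g X)) ∎
    where
    open ≡-Reasoning
    regroup : ∀ g a b → g * (a * b) ≡ b * (a * g)
    regroup = solve-∀

  ∑-t-lines-secant : ∑[ l < nl ] (ι (not (isM l)) * ∣ L l ∩ S ∣) ≡ t * t-line-count
  ∑-t-lines-secant = trans (∑-cong on-t-line) (sym (*-distribˡ-sum t (λ l → ι (not (isM l)))))
    where
    on-t-line : ∀ l → ι (not (isM l)) * ∣ L l ∩ S ∣ ≡ t * ι (not (isM l))
    on-t-line l with isM l in isM≡
    ... | true  = sym (*-zeroʳ t)
    ... | false = trans (+-identityʳ _) (trans (t-line isM≡) (sym (*-identityʳ t)))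

  ∁-lookup : ∀ X → lookup (∁ S) X ≡ not (s X)
  ∁-lookup X = lookup-map X not S

  outer-t-flags : ℕ
  outer-t-flags = ∑[ X < np ] (ι (lookup (∁ S) X) * t-lines X)

  S-flag-count : ∣ S ∣ ≡ t * t-line-count
  S-flag-count = begin
      ∣ S ∣
    ≡⟨ ∣∣≡∑ι S ⟩
      ∑[ X < np ] ι (s X)
    ≡⟨ ∑-cong weight-one ⟩
      ∑[ X < np ] (ι (s X) * t-lines X)
    ≡⟨ ∑-t-lines (ι ∘ s) ⟩
      ∑[ l < nl ] (ι (not (isM l)) * ∑[ X < np ] (ι (I l X) * ι (s X)))
    ≡⟨ ∑-cong (λ l → cong (ι (not (isM l)) *_) (∣∩∣≡∑ι* (L l) S)) ⟨
      ∑[ l < nl ] (ι (not (isM l)) * ∣ L l ∩ S ∣)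
    ≡⟨ ∑-t-lines-secant ⟩
      t * t-line-count ∎
    where
    open ≡-Reasoning
    weight-one : ∀ X → ι (s X) ≡ ι (s X) * t-lines X
    weight-one X with s X in X∈S
    ... | true  = sym (trans (+-identityʳ _) (t-lines≡1 X∈S))
    ... | false = refl

  t-line-flag-count : t * t-line-count + outer-t-flags ≡ t-line-count * suc q
  t-line-flag-count = begin
      t * t-line-count + outer-t-flags
    ≡⟨ cong₂ _+_ (sym ∑-t-lines-secant)
                 (trans (∑-t-lines (ι ∘ lookup (∁ S)))
                        (∑-cong λ l → cong (ι (not (isM l)) *_) (sym (∣∩∣≡∑ι* (L l) (∁ S))))) ⟩
      ∑[ l < nl ] (ι (not (isM l)) * ∣ L l ∩ S ∣) + ∑[ l < nl ] (ι (not (isM l)) * ∣ L l ∩ ∁ S ∣)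
    ≡⟨ ∑-distrib-+ (λ l → ι (not (isM l)) * ∣ L l ∩ S ∣) _ ⟨
      ∑[ l < nl ] (ι (not (isM l)) * ∣ L l ∩ S ∣ + ι (not (isM l)) * ∣ L l ∩ ∁ S ∣)
    ≡⟨ ∑-cong (λ l → trans (sym (*-distribˡ-+ (ι (not (isM l))) _ _))
                           (trans (cong (ι (not (isM l)) *_) (cosecant≡ l)) (*-comm _ (suc q)))) ⟩
      ∑[ l < nl ] (suc q * ι (not (isM l)))
    ≡⟨ *-distribˡ-sum (suc q) (λ l → ι (not (isM l))) ⟨
      suc q * t-line-count
    ≡⟨ *-comm (suc q) t-line-count ⟩
      t-line-count * suc q ∎
    where open ≡-Reasoning

  outside-term : ∀ {l X} → I l X ≡ true → s X ≡ false → ι (I l X) * ι (lookup (∁ S) X) ≡ 1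
  outside-term {l} {X} X∈l X∉S = cong₂ (λ a b → ι a * ι b) X∈l (trans (∁-lookup X) (cong not X∉S))

  two-outside : ∀ {l X Y} → X ≢ Y → I l X ≡ true → I l Y ≡ true → s X ≡ false → s Y ≡ false →
                2 ≤ ∣ L l ∩ ∁ S ∣
  two-outside {l} {X} {Y} X≢Y X∈l Y∈l X∉S Y∉S =
    subst₂ _≤_ (cong₂ _+_ (outside-term X∈l X∉S) (outside-term Y∈l Y∉S)) (sym (∣∩∣≡∑ι* (L l) (∁ S)))
      (two-terms≤∑ (λ Z → ι (I l Z) * ι (lookup (∁ S) Z)) X≢Y)

  module LargeM (d′ : ℕ) (m≡t+d : m ≡ t + suc d′) where
    d : ℕ
    d = suc d′

    d*t-lines≡ : ∀ {Q} → s Q ≡ false → d * t-lines Q ≡ d + q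
    d*t-lines≡ Q∉S = m≡t+d⇒d*b≡d+q (identity-outside Q∉S) m≡t+d

    d∣q : d ∣ q
    d∣q = ∣m+n∣m⇒∣n (subst (d ∣_) (d*t-lines≡ Q₀∉S) (m∣m*n (t-lines Q₀))) ∣-refl

    -- the number of points of an m-line outside S
    t′ : ℕ
    t′ = suc q ∸ m

    t+t′+d≡1+q : t + t′ + d ≡ suc q
    t+t′+d≡1+q = trans (regroup t t′ d) (trans (cong (_+ t′) (sym m≡t+d)) (m+[n∸m]≡n m≤1+q))
      where
      regroup : ∀ t t′ d → t + t′ + d ≡ t + d + t′
      regroup = solve-∀

    d*outer-t-flags : d * outer-t-flags ≡ (d + q) * ∣ ∁ S ∣
    d*outer-t-flags = begin
        d * outer-t-flags
      ≡⟨ *-distribˡ-sum d (λ X → ι (lookup (∁ S) X) * t-lines X) ⟩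
        ∑[ X < np ] (d * (ι (lookup (∁ S) X) * t-lines X))
      ≡⟨ ∑-cong outside-weight ⟩
        ∑[ X < np ] ((d + q) * ι (lookup (∁ S) X))
      ≡⟨ *-distribˡ-sum (d + q) (λ X → ι (lookup (∁ S) X)) ⟨
        (d + q) * ∑[ X < np ] ι (lookup (∁ S) X)
      ≡⟨ cong ((d + q) *_) (∣∣≡∑ι (∁ S)) ⟨
        (d + q) * ∣ ∁ S ∣ ∎
      where
      open ≡-Reasoning
      outside-weight : ∀ X → d * (ι (lookup (∁ S) X) * t-lines X) ≡ (d + q) * ι (lookup (∁ S) X)
      outside-weight X with lookup (∁ S) X in X∈∁S
      ... | false = trans (*-zeroʳ d) (sym (*-zeroʳ (d + q)))
      ... | true  = trans (cong (d *_) (+-identityʳ _))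
                      (trans (d*t-lines≡ (not-injective (trans (sym (∁-lookup X)) X∈∁S)))
                             (sym (*-identityʳ (d + q))))

    t*t′+d≡d*d : t * t′ + d ≡ d * d
    t*t′+d≡d*d = double-count-arithmetic (≤-trans (s≤s z≤n) 2≤q) t+t′+d≡1+q
                   (subst (λ m → ∣ S ∣ + q ≡ q * m + t) m≡t+d size)
                   points+q≡ ∣S∣+∣∁S∣≡np S-flag-count t-line-flag-count d*outer-t-flags

    point-complement : d′ ≡ 0 → Point-complement
    point-complement refl = t≡q , m≡1+q , Q₀ , λ x → mk⇔ not-Q₀ in-S
      where
      not-Q₀ : ∀ {x} → x ∈ S → x ≢ Q₀
      not-Q₀ x∈S refl = contradiction (trans (sym ([]=⇒lookup x∈S)) Q₀∉S) λ ()
      t′≡0 : t′ ≡ 0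
      t′≡0 = [ (λ t≡0 → contradiction t≡0 t≢0) , (λ t′≡0 → t′≡0) ]′ (m*n≡0⇒m≡0∨n≡0 t t*t′≡0)
        where
        t*t′≡0 : t * t′ ≡ 0
        t*t′≡0 = +-cancelʳ-≡ 1 (t * t′) 0 t*t′+d≡d*d
      t≡q : t ≡ q
      t≡q = suc-injective (trans (regroup t) (trans (cong (λ t′ → t + t′ + 1) (sym t′≡0)) t+t′+d≡1+q))
        where
        regroup : ∀ t → suc t ≡ t + 0 + 1
        regroup = solve-∀
      m≡1+q : m ≡ suc q
      m≡1+q = trans m≡t+d (trans (+-comm t 1) (cong suc t≡q))
      in-S : ∀ {x} → x ≢ Q₀ → x ∈ S
      in-S {x} x≢Q₀ with s x in x∈S
      ... | true  = lookup⇒[]= x S x∈S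
      ... | false = contradiction (cosecant≡ (join x≢Q₀)) (>⇒≢ q+2≤)
        where
        q≤secant : q ≤ ∣ L (join x≢Q₀) ∩ S ∣
        q≤secant with secant (join x≢Q₀)
        ... | inj₁ ∣l∩S∣≡m = subst (q ≤_) (sym (trans ∣l∩S∣≡m m≡1+q)) (n≤1+n q)
        ... | inj₂ ∣l∩S∣≡t = ≤-reflexive (sym (trans ∣l∩S∣≡t t≡q))
        2≤cosecant : 2 ≤ ∣ L (join x≢Q₀) ∩ ∁ S ∣
        2≤cosecant = two-outside x≢Q₀ (join-∋ˡ x≢Q₀) (join-∋ʳ x≢Q₀) x∈S Q₀∉S
        q+2≤ : suc (suc q) ≤ ∣ L (join x≢Q₀) ∩ S ∣ + ∣ L (join x≢Q₀) ∩ ∁ S ∣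
        q+2≤ = subst (_≤ ∣ L (join x≢Q₀) ∩ S ∣ + ∣ L (join x≢Q₀) ∩ ∁ S ∣) (+-comm q 2)
                     (+-mono-≤ q≤secant 2≤cosecant)

    unital : d * d ≡ q → t ≡ 1 → Unital
    unital d*d≡q t≡1 = d , d*d≡q , t≡1 , m≡d+1 , ∣S∣≡q*d+1 , secant-1-or-d+1
      where
      m≡d+1 : m ≡ d + 1
      m≡d+1 = trans m≡t+d (trans (cong (_+ d) t≡1) (+-comm 1 d))
      ∣S∣≡q*d+1 : ∣ S ∣ ≡ q * d + 1
      ∣S∣≡q*d+1 = +-cancelʳ-≡ q _ _ (trans size (trans (cong₂ (λ m t → q * m + t) m≡d+1 t≡1) (regroup q d)))
        where
        regroup : ∀ q d → q * (d + 1) + 1 ≡ q * d + 1 + q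
        regroup = solve-∀
      secant-1-or-d+1 : ∀ l → ∣ L l ∩ S ∣ ≡ 1 ⊎ ∣ L l ∩ S ∣ ≡ d + 1
      secant-1-or-d+1 l with secant l
      ... | inj₁ ∣l∩S∣≡m = inj₂ (trans ∣l∩S∣≡m m≡d+1)
      ... | inj₂ ∣l∩S∣≡t = inj₁ (trans ∣l∩S∣≡t t≡1)

    module Baer (2≤d : 2 ≤ d) (d*d≡q : d * d ≡ q) (t′≡1 : t′ ≡ 1) where
      t+d≡q : t + d ≡ q
      t+d≡q = suc-injective (trans (regroup t d) (trans (cong (λ t′ → t + t′ + d) (sym t′≡1)) t+t′+d≡1+q))
        where
        regroup : ∀ t d → suc (t + d) ≡ t + 1 + d
        regroup = solve-∀

      m≡q : m ≡ q
      m≡q = trans m≡t+d t+d≡q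

      t≡q∸d : t ≡ q ∸ d
      t≡q∸d = trans (sym (m+n∸n≡m t d)) (cong (_∸ d) t+d≡q)

      cosecant-m-line : ∀ {l} → isM l ≡ true → ∣ L l ∩ ∁ S ∣ ≡ 1
      cosecant-m-line {l} isM≡ =
        +-cancelˡ-≡ q _ _ (trans (cong (_+ ∣ L l ∩ ∁ S ∣) (sym (trans (m-line isM≡) m≡q)))
                                 (trans (cosecant≡ l) (+-comm 1 q)))

      cosecant-t-line : ∀ {l} → isM l ≡ false → ∣ L l ∩ ∁ S ∣ ≡ suc d
      cosecant-t-line {l} isT =
        +-cancelˡ-≡ t _ _ (trans (cong (_+ ∣ L l ∩ ∁ S ∣) (sym (t-line isT)))
                                 (trans (cosecant≡ l) (trans (cong suc (sym t+d≡q)) (sym (+-suc t d)))))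

      2≤cosecant⇒t-line : ∀ {l} → 2 ≤ ∣ L l ∩ ∁ S ∣ → isM l ≡ false
      2≤cosecant⇒t-line {l} 2≤ with isM l in isM≡
      ... | false = refl
      ... | true  = contradiction (subst (2 ≤_) (cosecant-m-line isM≡) 2≤) λ { (s≤s ()) }

      lines-of-∁S : (l : Fin nl) → 2 ≤ ∣ L l ∩ ∁ S ∣ → ∣ L l ∩ ∁ S ∣ ≡ suc d
      lines-of-∁S l 2≤ = cosecant-t-line (2≤cosecant⇒t-line 2≤)

      t-lines-meet-in-∁S : ∀ {l l′} → isM l ≡ false → isM l′ ≡ false →
                           ∃ λ X → X ∈ ∁ S × X ∈ L l × X ∈ L l′
      t-lines-meet-in-∁S {l} {l′} isT isT′ with l ≟F l′
      ... | yes refl =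
        let X , X∈l∩∁S = ∣p∣≢0⇒Nonempty (L l ∩ ∁ S)
                           (λ ≡0 → contradiction (trans (sym (cosecant-t-line isT)) ≡0) λ ())
            X∈l , X∈∁S = x∈p∩q⁻ (L l) (∁ S) X∈l∩∁S
        in X , X∈∁S , X∈l , X∈l
      ... | no l≢l′ =
        let X , X∈l∩l′ = ∣p∣≢0⇒Nonempty (L l ∩ L l′)
                           (λ ≡0 → contradiction (trans (sym (meetL l l′ l≢l′)) ≡0) λ ())
            X∈l , X∈l′ = x∈p∩q⁻ (L l) (L l′) X∈l∩l′
        in X , x∉p⇒x∈∁p (λ X∈S → >⇒≢ (2≤t-lines X∈l X∈l′) (t-lines≡1 ([]=⇒lookup X∈S))) , X∈l , X∈l′
        where
        2≤t-lines : ∀ {X} → X ∈ L l → X ∈ L l′ → 2 ≤ t-lines X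
        2≤t-lines {X} X∈l X∈l′ =
          subst (_≤ t-lines X) (cong₂ _+_ (cong₂ (λ a b → ι a * ι (not b)) ([]=⇒lookup X∈l) isT)
                                          (cong₂ (λ a b → ι a * ι (not b)) ([]=⇒lookup X∈l′) isT′))
            (two-terms≤∑ (λ k → ι (I k X) * ι (not (isM k))) l≢l′)

      t-lines-Q₀≡1+d : t-lines Q₀ ≡ suc d
      t-lines-Q₀≡1+d = *-cancelˡ-≡ (t-lines Q₀) (suc d) d
                         (trans (d*t-lines≡ Q₀∉S) (trans (cong (d +_) (sym d*d≡q)) (sym (*-suc d d))))

      two-more-points : ∀ {l} → isM l ≡ false → ∀ P → ∃ λ A → ∃ λ A′ → A ≢ A′ × A ≢ P × A′ ≢ P ×
                          (I l A ≡ true × A ∈ ∁ S) × (I l A′ ≡ true × A′ ∈ ∁ S)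
      two-more-points {l} isT P =
        let A , A′ , A≢A′ , A≢P , A′≢P , A≢0 , A′≢0 =
              ∃-two-others point-of-∁S (λ X → ι*ι≤1 (I l X) _) 3≤∑ P
        in A , A′ , A≢A′ , A≢P , A′≢P , on A≢0 , on A′≢0
        where
        point-of-∁S : Fin np → ℕ
        point-of-∁S X = ι (I l X) * ι (lookup (∁ S) X)
        3≤∑ : 3 ≤ ∑[ X < np ] point-of-∁S X
        3≤∑ = subst (3 ≤_) (trans (sym (cosecant-t-line isT)) (∣∩∣≡∑ι* (L l) (∁ S))) (s≤s 2≤d)
        on : ∀ {X} → point-of-∁S X ≢ 0 → I l X ≡ true × X ∈ ∁ S
        on {X} ≢0 = let X∈l , X∈∁S = ι*ι≢0⇒≡true ≢0 in X∈l , lookup⇒[]= X (∁ S) X∈∁S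

      quadrangle-on : ∀ {l₁ l₂} → l₁ ≢ l₂ → I l₁ Q₀ ≡ true → I l₂ Q₀ ≡ true →
                      isM l₁ ≡ false → isM l₂ ≡ false →
                      Σ (Fin 4 → Fin np) λ f → ((i : Fin 4) → f i ∈ ∁ S) × GeneralPosition L f
      quadrangle-on {l₁} {l₂} l₁≢l₂ Q₀∈l₁ Q₀∈l₂ isT₁ isT₂ =
        let A , A′ , A≢A′ , A≢Q₀ , A′≢Q₀ , (A∈l₁ , A∈∁S) , (A′∈l₁ , A′∈∁S) = two-more-points isT₁ Q₀
            B , B′ , B≢B′ , B≢Q₀ , B′≢Q₀ , (B∈l₂ , B∈∁S) , (B′∈l₂ , B′∈∁S) = two-more-points isT₂ Q₀
        in ⟨ A , A′ , B , B′ ⟩ , (λ { 0F → A∈∁S ; 1F → A′∈∁S ; 2F → B∈∁S ; 3F → B′∈∁S }) ,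
           quadrangle l₁≢l₂ A≢A′ A∈l₁ A′∈l₁ (off₂ A∈l₁ A≢Q₀) (off₂ A′∈l₁ A′≢Q₀)
                            B≢B′ B∈l₂ B′∈l₂ (off₁ B∈l₂ B≢Q₀) (off₁ B′∈l₂ B′≢Q₀)
        where
        off₂ : ∀ {X} → I l₁ X ≡ true → X ≢ Q₀ → I l₂ X ≡ false
        off₂ = off-second-line l₁≢l₂ Q₀∈l₁ Q₀∈l₂
        off₁ : ∀ {X} → I l₂ X ≡ true → X ≢ Q₀ → I l₁ X ≡ false
        off₁ = off-second-line (l₁≢l₂ ∘ sym) Q₀∈l₂ Q₀∈l₁

      quadrangle-in-∁S : Σ (Fin 4 → Fin np) λ f → ((i : Fin 4) → f i ∈ ∁ S) × GeneralPosition L f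
      quadrangle-in-∁S =
        let l₁ , l₂ , l₁≢l₂ , ≢0₁ , ≢0₂ =
              ∃-two≢0 (λ l → ι (I l Q₀) * ι (not (isM l))) (λ l → ι*ι≤1 (I l Q₀) _) 2≤t-lines-Q₀
            Q₀∈l₁ , isT₁ = ι*ι≢0⇒≡true ≢0₁
            Q₀∈l₂ , isT₂ = ι*ι≢0⇒≡true ≢0₂
        in quadrangle-on l₁≢l₂ Q₀∈l₁ Q₀∈l₂ (not-injective isT₁) (not-injective isT₂)
        where
        2≤t-lines-Q₀ : 2 ≤ t-lines Q₀
        2≤t-lines-Q₀ = subst (2 ≤_) (sym t-lines-Q₀≡1+d) (s≤s (≤-trans (s≤s z≤n) 2≤d))

      ∁S-subplane : Σ (Subset np) λ B → S ≡ ∁ B × IsSubplane Π d B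
      ∁S-subplane = ∁ S , sym (∁-involutive S) , lines-of-∁S , meet , quadrangle-in-∁S
        where
        meet : (l l′ : Fin nl) → 2 ≤ ∣ L l ∩ ∁ S ∣ → 2 ≤ ∣ L l′ ∩ ∁ S ∣ →
               ∃ λ X → X ∈ ∁ S × X ∈ L l × X ∈ L l′
        meet l l′ 2≤ 2≤′ = t-lines-meet-in-∁S (2≤cosecant⇒t-line 2≤) (2≤cosecant⇒t-line 2≤′)

    square-root-case : IsPrimePower q → 2 ≤ d → Unital ⊎ Baer-complement
    square-root-case pp 2≤d = by-cases (prime-power-divisor-square pp 2≤d d∣q t*t′+d≡d*d t+t′+d≡1+q)
      where
      by-cases : d * d ≡ q × (t ≡ 1 ⊎ t′ ≡ 1) → Unital ⊎ Baer-complement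
      by-cases (d*d≡q , inj₁ t≡1)  = inj₁ (unital d*d≡q t≡1)
      by-cases (d*d≡q , inj₂ t′≡1) = inj₂ (d , d*d≡q , t≡q∸d , m≡q , ∁S-subplane)
        where open Baer 2≤d d*d≡q t′≡1

  large-m-case : IsPrimePower q → t < m → Unital ⊎ Baer-complement ⊎ Point-complement
  large-m-case pp t<m =
    let d′ , 1+t+d′≡m = m≤n⇒∃[o]m+o≡n t<m in by-excess d′ (trans (sym 1+t+d′≡m) (sym (+-suc t d′)))
    where
    by-excess : ∀ d′ → m ≡ t + suc d′ → Unital ⊎ Baer-complement ⊎ Point-complement
    by-excess zero     m≡t+1    = inj₂ (inj₂ (LargeM.point-complement 0 m≡t+1 refl))
    by-excess (suc d″) m≡t+2+d″ = map₂ inj₁ (LargeM.square-root-case (suc d″) m≡t+2+d″ pp (s≤s (s≤s z≤n)))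

  classification : IsPrimePower q → Collinear ⊎ Unital ⊎ Baer-complement ⊎ Point-complement
  classification pp with <-cmp m t
  ... | tri< m<t _ _ = inj₁ (collinear-case m<t)
  ... | tri≈ _ m≡t _ = contradiction m≡t m≢t
  ... | tri> _ _ t<m = inj₂ (large-m-case pp t<m)

theorem2p6 : (q : ℕ) → IsPrimePower q → (Π : ProjectivePlane q) →
    (S : Subset (ProjectivePlane.np Π)) → (m t : ℕ) →
    IsGenKMArc Π S m t → NoZeroSecant Π S →
    (m ≡ 1 × IsCollinearQ+1 Π S)
    ⊎ (Σ ℕ λ r → r * r ≡ q × t ≡ 1 × m ≡ r + 1 × IsUnital Π r S)
    ⊎ (Σ ℕ λ r → r * r ≡ q × t ≡ q ∸ r × m ≡ q ×
         Σ (Subset (ProjectivePlane.np Π)) λ B → S ≡ ∁ B × IsSubplane Π r B)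
    ⊎ (t ≡ q × m ≡ suc q ×
         Σ (Fin (ProjectivePlane.np Π)) λ p →
           (x : Fin (ProjectivePlane.np Π)) → (x ∈ S ⇔ x ≢ p))
theorem2p6 q pp Π S m t arc no0 = KMArc.classification (prime-power≥2 pp) Π arc no0 pp
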